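{- Let $A$ be a density-1 real and $f:\mathbb{N}\to\mathbb{N}$ a function such that there is a Turing functional $\varphi$ with $\varphi^g$ a generic computation of $A$ for every $g\gg f$. Then there exists a bigger-is-less Turing functional $\psi$ which only outputs 1's such that for every $g\gg f$, $\psi^g$ is a generic computation of $A$.
   Context: Reals are subsets of $\mathbb{N}$; $n=\{0,\dots,n-1\}$; a real $A$ is density-1 if $\lim_{n\to\infty}|A\cap n|/n=1$. For functions $f,g:\mathbb{N}\to\mathbb{N}$, $g\gg f$ ($g$ dominates $f$) means $g(n)\geq f(n)$ for all $n$. For an oracle $X$ and Turing functional $\varphi$, $\varphi^X$ is a generic computation of $A$ if $\mathrm{dom}(\varphi^X)$ is density-1, $\varphi^X$ has values in $\{0,1\}$, and agrees with $A$ on its domain. A Turing functional $\psi$ only outputs 1's if for every oracle $X$ and $n$, $\psi^X(n)\downarrow$ implies $\psi^X(n)=1$. A functional $\psi$ that only outputs 1's is bigger-is-less if for all functions $g,h:\mathbb{N}\to\mathbb{N}$ with $h\gg g$, $\mathrm{dom}(\psi^h)\subseteq\mathrm{dom}(\psi^g)$. -}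

module Defs where

open import Data.Nat using (ℕ; zero; suc; _≤_; _<_; _*_; _≡ᵇ_)
open import Data.Bool using (Bool; true; false; if_then_else_)
open import Data.List using (List; []; _∷_; length)
open import Data.List.Relation.Unary.All using (All)
open import Data.List.Relation.Unary.Unique.Propositional using (Unique)
open import Data.Maybe using (Maybe; just; nothing)
open import Data.Product using (Σ; ∃; _×_; _,_)
open import Data.Sum using (_⊎_)
open import Relation.Binary.PropositionalEquality using (_≡_)

-- Model of Turing functionals: oracle register (counter) machines.
-- Registers hold naturals; the oracle is a total function X : ℕ → ℕ.

data Instr : Set where
  inc   : ℕ → Instr
  decjz : ℕ → ℕ → Instr      -- if R[r] = 0 then goto l else R[r] := R[r] - 1 ; next
  orc   : ℕ → ℕ → Instr      -- R[d] := X (R[s]) ; next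

Functional : Set
Functional = List Instr

Regs : Set
Regs = ℕ → ℕ

setReg : ℕ → ℕ → Regs → Regs
setReg r v R i = if i ≡ᵇ r then v else R i

nth : List Instr → ℕ → Maybe Instr
nth []       _       = nothing
nth (x ∷ xs) zero    = just x
nth (x ∷ xs) (suc n) = nth xs n

-- run with a fuel bound; halts when the program counter leaves the program,
-- output = register 0.
mutual
  run : Functional → (ℕ → ℕ) → ℕ → ℕ → Regs → Maybe ℕ
  run P X zero    pc R = nothing
  run P X (suc t) pc R = exec P X t pc R (nth P pc)

  exec : Functional → (ℕ → ℕ) → ℕ → ℕ → Regs → Maybe Instr → Maybe ℕ
  exec P X t pc R nothing            = just (R 0)
  exec P X t pc R (just (inc r))     = run P X t (suc pc) (setReg r (suc (R r)) R)
  exec P X t pc R (just (decjz r l)) = branch P X t pc R r l (R r)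
  exec P X t pc R (just (orc d s))   = run P X t (suc pc) (setReg d (X (R s)) R)

  branch : Functional → (ℕ → ℕ) → ℕ → ℕ → Regs → ℕ → ℕ → ℕ → Maybe ℕ
  branch P X t pc R r l zero    = run P X t l R
  branch P X t pc R r l (suc m) = run P X t (suc pc) (setReg r m R)

initRegs : ℕ → Regs
initRegs n = setReg 0 n (λ _ → 0)

_^_⟨_⟩≃_ : Functional → (ℕ → ℕ) → ℕ → ℕ → Set
φ ^ X ⟨ n ⟩≃ v = ∃ λ t → run φ X t 0 (initRegs n) ≡ just v

Dom : Functional → (ℕ → ℕ) → ℕ → Set
Dom φ X n = ∃ λ v → φ ^ X ⟨ n ⟩≃ v

-- Density 1 of a set P ⊆ ℕ:  lim |P ∩ n| / n = 1, unfolded as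
-- for every k there is N such that for all n ≥ N, |P ∩ n| ≥ (k/(k+1))·n,
-- where "|P ∩ n| ≥ m" is witnessed by a duplicate-free list of elements
-- of P ∩ n of length ≥ m.
Density1 : (ℕ → Set) → Set
Density1 P = ∀ (k : ℕ) → ∃ λ N → ∀ n → N ≤ n →
  ∃ λ (xs : List ℕ) → Unique xs × All (λ x → x < n × P x) xs
                      × n * k ≤ length xs * suc k

Real : Set
Real = ℕ → Bool

_∈R_ : ℕ → Real → Set
n ∈R A = A n ≡ true

bit : Bool → ℕ
bit true  = 1
bit false = 0

_≫_ : (ℕ → ℕ) → (ℕ → ℕ) → Set
g ≫ f = ∀ n → f n ≤ g n

GenericComputation : Functional → (ℕ → ℕ) → Real → Set
GenericComputation φ X A =
  Density1 (Dom φ X)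
  × (∀ n v → φ ^ X ⟨ n ⟩≃ v → v ≡ 0 ⊎ v ≡ 1)
  × (∀ n v → φ ^ X ⟨ n ⟩≃ v → v ≡ bit (A n))

OnlyOutputsOnes : Functional → Set
OnlyOutputsOnes ψ = ∀ (X : ℕ → ℕ) n v → ψ ^ X ⟨ n ⟩≃ v → v ≡ 1

BiggerIsLess : Functional → Set
BiggerIsLess ψ = OnlyOutputsOnes ψ
  × (∀ (g h : ℕ → ℕ) → h ≫ g → ∀ n → Dom ψ h n → Dom ψ g n)

module Submission where

-- From φ we compile a functional ψ which, on input n,
-- searches through attempts j = 0, 1, 2, … .  Attempt j runs φ for j steps on
-- input n with the oracle X + offset j, where `offset j` is the infinite
-- sequence coded by the number j, and ψ halts with output 1 as soon as an
-- attempt outputs 1.  Every finite sequence is an initial segment of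
-- `offset c` for arbitrarily large c, and a halting run queries only finitely
-- many oracle values; hence
--     n ∈ dom ψ^X   ⟺   φ^Y(n) = 1 for some Y ≫ X.
-- The right-hand side is anti-monotone in X, which is bigger-is-less; for
-- X ≫ f every such Y ≫ f, so ψ^X agrees with A; and dom ψ^X contains
-- A ∩ dom φ^X, which is density-1 as an intersection of density-1 sets.

open import Defs
open import Data.Nat hiding (_^_)
open import Data.Nat.Properties
open import Data.Bool using (Bool; true; false; if_then_else_; T)
open import Data.List using (List; []; _∷_; length; _++_; replicate)
open import Data.List.Properties using (length-++)
open import Data.Maybe using (Maybe; just; nothing)
open import Data.Product using (∃; Σ; _×_; _,_; proj₁; proj₂)
open import Data.Sum using (_⊎_; inj₁; inj₂)
open import Data.Empty using (⊥; ⊥-elim)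
open import Data.Unit using (tt)
open import Relation.Nullary using (yes; no)
open import Relation.Binary.PropositionalEquality

≡ᵇ-true⇒≡ : ∀ a b → (a ≡ᵇ b) ≡ true → a ≡ b
≡ᵇ-true⇒≡ a b e = ≡ᵇ⇒≡ a b (subst T (sym e) tt)

≡ᵇ-refl : ∀ a → (a ≡ᵇ a) ≡ true
≡ᵇ-refl zero = refl
≡ᵇ-refl (suc a) = ≡ᵇ-refl a

≡ᵇ-sym : ∀ a b → (a ≡ᵇ b) ≡ (b ≡ᵇ a)
≡ᵇ-sym zero zero = refl
≡ᵇ-sym zero (suc b) = refl
≡ᵇ-sym (suc a) zero = refl
≡ᵇ-sym (suc a) (suc b) = ≡ᵇ-sym a b

-- `a ≠ᵇ b`: the register indices a and b are distinct, decided by evaluation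
-- (so that `refl` proves it for concrete indices).
_≠ᵇ_ : ℕ → ℕ → Set
a ≠ᵇ b = (a ≡ᵇ b) ≡ false

≢⇒≠ᵇ : ∀ a b → a ≢ b → a ≠ᵇ b
≢⇒≠ᵇ a b ne with a ≡ᵇ b in e
... | true = ⊥-elim (ne (≡ᵇ-true⇒≡ a b e))
... | false = refl

≡ᵇ-distinct : ∀ i a b → (i ≡ᵇ a) ≡ true → (i ≡ᵇ b) ≡ true → a ≠ᵇ b → ⊥
≡ᵇ-distinct i a b e1 e2 n with ≡ᵇ-true⇒≡ i a e1 | ≡ᵇ-true⇒≡ i b e2
... | refl | refl with trans (sym (≡ᵇ-refl i)) n
... | ()

-- Register files.  They are compared pointwise (`_≗_`), since `setReg`
-- builds functions.

setReg-same : ∀ r v R → setReg r v R r ≡ v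
setReg-same r v R rewrite ≡ᵇ-refl r = refl

setReg-other : ∀ r v R i → i ≠ᵇ r → setReg r v R i ≡ R i
setReg-other r v R i e rewrite e = refl

setReg-cong : ∀ r v {R R'} → R ≗ R' → setReg r v R ≗ setReg r v R'
setReg-cong r v e i with i ≡ᵇ r
... | true = refl
... | false = e i

setReg-noop : ∀ {r v R} → R r ≡ v → R ≗ setReg r v R
setReg-noop {r} {v} {R} e i with i ≡ᵇ r in e1
... | true rewrite ≡ᵇ-true⇒≡ i r e1 = e
... | false = refl

setReg-overwrite : ∀ {r a b R} → setReg r a (setReg r b R) ≗ setReg r a R
setReg-overwrite {r} i with i ≡ᵇ r
... | true = refl
... | false = refl

setReg-add : ∀ R r x y → setReg r (setReg r x R r + y) (setReg r x R) ≗ setReg r (x + y) R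
setReg-add R r x y i with i ≡ᵇ r
... | true rewrite ≡ᵇ-refl r = refl
... | false = refl

-- The decoding macros below use only the fixed registers 0…9, so identities
-- between their register files are checked at these ten registers and,
-- uniformly, above them.
byRegister : (Q : ℕ → Set) → Q 0 → Q 1 → Q 2 → Q 3 → Q 4 → Q 5 → Q 6 → Q 7 → Q 8 → Q 9
  → (∀ k → Q (10 + k)) → ∀ i → Q i
byRegister Q q0 q1 q2 q3 q4 q5 q6 q7 q8 q9 qk 0 = q0
byRegister Q q0 q1 q2 q3 q4 q5 q6 q7 q8 q9 qk 1 = q1
byRegister Q q0 q1 q2 q3 q4 q5 q6 q7 q8 q9 qk 2 = q2
byRegister Q q0 q1 q2 q3 q4 q5 q6 q7 q8 q9 qk 3 = q3
byRegister Q q0 q1 q2 q3 q4 q5 q6 q7 q8 q9 qk 4 = q4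
byRegister Q q0 q1 q2 q3 q4 q5 q6 q7 q8 q9 qk 5 = q5
byRegister Q q0 q1 q2 q3 q4 q5 q6 q7 q8 q9 qk 6 = q6
byRegister Q q0 q1 q2 q3 q4 q5 q6 q7 q8 q9 qk 7 = q7
byRegister Q q0 q1 q2 q3 q4 q5 q6 q7 q8 q9 qk 8 = q8
byRegister Q q0 q1 q2 q3 q4 q5 q6 q7 q8 q9 qk 9 = q9
byRegister Q q0 q1 q2 q3 q4 q5 q6 q7 q8 q9 qk (suc (suc (suc (suc (suc (suc (suc (suc (suc (suc k)))))))))) = qk k

nth-++ˡ : ∀ xs ys i {x} → nth xs i ≡ just x → nth (xs ++ ys) i ≡ just x
nth-++ˡ (x ∷ xs) ys zero e = e
nth-++ˡ (x ∷ xs) ys (suc i) e = nth-++ˡ xs ys i e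

nth-++ʳ : ∀ xs ys i → nth (xs ++ ys) (i + length xs) ≡ nth ys i
nth-++ʳ [] ys i rewrite +-identityʳ i = refl
nth-++ʳ (x ∷ xs) ys i rewrite +-suc i (length xs) = nth-++ʳ xs ys i

nth-defined : ∀ xs p → p < length xs → Σ Instr λ x → nth xs p ≡ just x
nth-defined (y ∷ xs) zero lt = y , refl
nth-defined (y ∷ xs) (suc p) (s≤s lt) = nth-defined xs p lt

nth-past-end : ∀ (xs : List Instr) p → length xs ≤ p → nth xs p ≡ nothing
nth-past-end [] p le = refl
nth-past-end (y ∷ xs) (suc p) (s≤s le) = nth-past-end xs p le

run-cong : ∀ P X t pc {R R'} → R ≗ R' → run P X t pc R ≡ run P X t pc R'
run-cong P X zero pc e = refl
run-cong P X (suc t) pc {R} {R'} e with nth P pc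
... | nothing = cong just (e 0)
... | just (inc r) rewrite e r = run-cong P X t (suc pc) (setReg-cong r (suc (R' r)) e)
... | just (orc d s) rewrite e s = run-cong P X t (suc pc) (setReg-cong d (X (R' s)) e)
... | just (decjz r l) rewrite e r with R' r
...   | zero = run-cong P X t l e
...   | suc v = run-cong P X t (suc pc) (setReg-cong r v e)

run-extend : ∀ P X t k pc R {v} → run P X t pc R ≡ just v → run P X (t + k) pc R ≡ just v
run-extend P X zero k pc R ()
run-extend P X (suc t) k pc R eq with nth P pc
... | nothing = eq
... | just (inc r) = run-extend P X t k (suc pc) _ eq
... | just (orc d s) = run-extend P X t k (suc pc) _ eq
... | just (decjz r l) with R r
...   | zero = run-extend P X t k l R eq
...   | suc v = run-extend P X t k (suc pc) _ eq

run-mono : ∀ P X t t' pc R {v} → t ≤ t' → run P X t pc R ≡ just v → run P X t' pc R ≡ just v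
run-mono P X t t' pc R le eq with m≤n⇒∃[o]m+o≡n le
... | k , refl = run-extend P X t k pc R eq

run-deterministic : ∀ P X t t' pc R {v v'} → run P X t pc R ≡ just v → run P X t' pc R ≡ just v' → v ≡ v'
run-deterministic P X t t' pc R e e' = just-injective
  (trans (sym (run-mono P X t (t ⊔ t') pc R (m≤m⊔n t t') e)) (run-mono P X t' (t ⊔ t') pc R (m≤n⊔m t t') e'))
  where
  just-injective : ∀ {a b : ℕ} → just a ≡ just b → a ≡ b
  just-injective refl = refl

run-local : ∀ P X t pc R {v} → run P X t pc R ≡ just v
  → Σ ℕ λ B → ∀ Y → (∀ i → i < B → Y i ≡ X i) → run P Y t pc R ≡ just v
run-local P X zero pc R ()
run-local P X (suc t) pc R e with nth P pc
... | nothing = 0 , λ Y ag → e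
... | just (inc r) = run-local P X t (suc pc) _ e
... | just (decjz r l) with R r
...   | zero = run-local P X t l R e
...   | suc w = run-local P X t (suc pc) _ e
run-local P X (suc t) pc R e | just (orc d s) with run-local P X t (suc pc) (setReg d (X (R s)) R) e
... | B , f = suc (R s) ⊔ B , λ Y ag →
      trans (cong (λ z → run P Y t (suc pc) (setReg d z R)) (ag (R s) (m≤m⊔n (suc (R s)) B)))
            (f Y (λ i lt → ag i (≤-trans lt (m≤n⊔m (suc (R s)) B))))

run-past-end : ∀ P X t l R → length P ≤ l → run P X t l R ≡ run P X t (length P) R
run-past-end P X zero l R le = refl
run-past-end P X (suc t) l R le rewrite nth-past-end P l le | nth-past-end P (length P) ≤-refl = refl

run-clamp : ∀ P X t l R → run P X t l R ≡ run P X t (l ⊓ length P) R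
run-clamp P X t l R with ≤-total l (length P)
... | inj₁ le rewrite m≤n⇒m⊓n≡m le = refl
... | inj₂ ge rewrite m≥n⇒m⊓n≡n ge = run-past-end P X t l R ge

Reach : Functional → (ℕ → ℕ) → ℕ → Regs → ℕ → Regs → Set
Reach P X pc R pc' R' = Σ ℕ λ k → ∀ t → run P X (k + t) pc R ≡ run P X t pc' R'

reach-refl : ∀ {P X pc R} → Reach P X pc R pc R
reach-refl = 0 , λ t → refl

infixr 4 _▸_
_▸_ : ∀ {P X pc R pc' R' pc'' R''} → Reach P X pc R pc' R' → Reach P X pc' R' pc'' R'' → Reach P X pc R pc'' R''
_▸_ {P} {X} {pc} {R} (k1 , e1) (k2 , e2) =
  k1 + k2 , λ t → trans (cong (λ z → run P X z pc R) (+-assoc k1 k2 t)) (trans (e1 (k2 + t)) (e2 t))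

reach-regs : ∀ {P X pc R pc' R' R''} → R' ≗ R'' → Reach P X pc R pc' R' → Reach P X pc R pc' R''
reach-regs {P} {X} {pc' = pc'} e (k , f) = k , λ t → trans (f t) (run-cong P X t pc' e)

reach-pc : ∀ {P X pc R pc' pc'' R'} → pc' ≡ pc'' → Reach P X pc R pc' R' → Reach P X pc R pc'' R'
reach-pc refl r = r

reach-src : ∀ {P X pc pc' R pc'' R''} → pc ≡ pc' → Reach P X pc' R pc'' R'' → Reach P X pc R pc'' R''
reach-src refl r = r

-- A halting run from a state factors through every state reachable from it
-- (the run cannot halt before reaching it, as runs with zero fuel never halt).
reach-run : ∀ {P X pc R pc' R' v} t → (rc : Reach P X pc R pc' R') → run P X t pc R ≡ just v
  → Σ ℕ λ t' → t ≡ proj₁ rc + t' × run P X t' pc' R' ≡ just v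
reach-run {P} {X} {pc} {R} t (k , f) e with k ≤? t
... | yes le = let (t' , eq) = m≤n⇒∃[o]m+o≡n le
               in t' , sym eq , trans (sym (f t')) (trans (cong (λ z → run P X z pc R) eq) e)
... | no k≰t with trans (sym (f 0)) (run-mono P X t (k + 0) pc R (≤-trans (<⇒≤ (≰⇒> k≰t)) (m≤m+n k 0)) e)
...   | ()

step-inc : ∀ {P X pc R r} → nth P pc ≡ just (inc r) → Reach P X pc R (suc pc) (setReg r (suc (R r)) R)
step-inc {P} {X} {pc} {R} eq = 1 , λ t → cong (exec P X t pc R) eq

step-orc : ∀ {P X pc R d s} → nth P pc ≡ just (orc d s) → Reach P X pc R (suc pc) (setReg d (X (R s)) R)
step-orc {P} {X} {pc} {R} eq = 1 , λ t → cong (exec P X t pc R) eq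

step-jz : ∀ {P X pc R r l} → nth P pc ≡ just (decjz r l) → R r ≡ 0 → Reach P X pc R l R
step-jz {P} {X} {pc} {R} {r} {l} eq z = 1 , λ t → trans (cong (exec P X t pc R) eq) (cong (branch P X t pc R r l) z)

step-dec : ∀ {P X pc R r l v} → nth P pc ≡ just (decjz r l) → R r ≡ suc v → Reach P X pc R (suc pc) (setReg r v R)
step-dec {P} {X} {pc} {R} {r} {l} eq z = 1 , λ t → trans (cong (exec P X t pc R) eq) (cong (branch P X t pc R r l) z)

Loaded : Functional → ℕ → List Instr → Set
Loaded P b B = ∀ i ins → nth B i ≡ just ins → nth P (i + b) ≡ just ins

loaded-++ˡ : ∀ {P b} B1 B2 → Loaded P b (B1 ++ B2) → Loaded P b B1
loaded-++ˡ B1 B2 h i ins e = h i ins (nth-++ˡ B1 B2 i e)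

loaded-++ʳ : ∀ {P b} B1 B2 → Loaded P b (B1 ++ B2) → Loaded P (length B1 + b) B2
loaded-++ʳ {P} {b} B1 B2 h i ins e rewrite sym (+-assoc i (length B1) b) =
  h (i + length B1) ins (trans (nth-++ʳ B1 B2 i) e)

loaded-at : ∀ {P b b' B} → b ≡ b' → Loaded P b B → Loaded P b' B
loaded-at refl h = h

SuffixAt : Functional → ℕ → List Instr → Set
SuffixAt P b B = ∀ i → nth P (i + b) ≡ nth B i

suffix-self : ∀ P → SuffixAt P 0 P
suffix-self P i rewrite +-identityʳ i = refl

suffix-++ʳ : ∀ {P b} B1 B2 → SuffixAt P b (B1 ++ B2) → SuffixAt P (length B1 + b) B2
suffix-++ʳ {P} {b} B1 B2 h i rewrite sym (+-assoc i (length B1) b) = trans (h (i + length B1)) (nth-++ʳ B1 B2 i)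

suffix-at : ∀ {P b b' B} → b ≡ b' → SuffixAt P b B → SuffixAt P b' B
suffix-at refl h = h

suffix⇒loaded : ∀ {P b B} → SuffixAt P b B → Loaded P b B
suffix⇒loaded h i ins e = trans (h i) e
-- Register 4 is kept at 0 throughout, so that `decjz 4 l` is an
-- unconditional jump; hence every macro requires its registers to differ from 4.

jmp : ℕ → Instr
jmp l = decjz 4 l

clearCode : ℕ → ℕ → List Instr
clearCode r b = decjz r (2 + b) ∷ jmp b ∷ []

clear-spec : ∀ {P X} r b → Loaded P b (clearCode r b) → 4 ≠ᵇ r → ∀ v R → R r ≡ v → R 4 ≡ 0
  → Reach P X b R (2 + b) (setReg r 0 R)
clear-spec r b h n4 zero R e z = reach-regs (setReg-noop e) (step-jz (h 0 _ refl) e)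
clear-spec r b h n4 (suc v) R e z =
  step-dec (h 0 _ refl) e ▸ step-jz (h 1 _ refl) (trans (setReg-other r v R 4 n4) z)
  ▸ reach-regs setReg-overwrite (clear-spec r b h n4 v (setReg r v R) (setReg-same r v R) (trans (setReg-other r v R 4 n4) z))

moveCode : ℕ → ℕ → ℕ → List Instr
moveCode src dst b = decjz src (3 + b) ∷ inc dst ∷ jmp b ∷ []

move-spec : ∀ {P X} src dst b → Loaded P b (moveCode src dst b) → dst ≠ᵇ src
  → 4 ≠ᵇ src → 4 ≠ᵇ dst → ∀ v R → R src ≡ v → R 4 ≡ 0
  → Reach P X b R (3 + b) (setReg src 0 (setReg dst (R dst + v) R))
move-spec src dst b h nd n4s n4d zero R e z = reach-regs ext (step-jz (h 0 _ refl) e)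
  where
  ext : R ≗ setReg src 0 (setReg dst (R dst + 0) R)
  ext i with i ≡ᵇ src in e1
  ... | true rewrite ≡ᵇ-true⇒≡ i src e1 = e
  ... | false with i ≡ᵇ dst in e2
  ... | true rewrite ≡ᵇ-true⇒≡ i dst e2 = sym (+-identityʳ _)
  ... | false = refl
move-spec {P} {X} src dst b h nd n4s n4d (suc v) R e z =
  step-dec (h 0 _ refl) e ▸ step-inc (h 1 _ refl) ▸ step-jz (h 2 _ refl) z2
  ▸ reach-regs ext (move-spec src dst b h nd n4s n4d v R2 e2 z2)
  where
  R1 = setReg src v R
  R2 = setReg dst (suc (R1 dst)) R1
  z2 : R2 4 ≡ 0
  z2 = trans (setReg-other dst _ R1 4 n4d) (trans (setReg-other src v R 4 n4s) z)
  e2 : R2 src ≡ v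
  e2 = trans (setReg-other dst _ R1 src (trans (≡ᵇ-sym src dst) nd)) (setReg-same src v R)
  R1d : R1 dst ≡ R dst
  R1d = setReg-other src v R dst nd
  ext : setReg src 0 (setReg dst (R2 dst + v) R2) ≗ setReg src 0 (setReg dst (R dst + suc v) R)
  ext i with i ≡ᵇ src in e1
  ... | true = refl
  ... | false with i ≡ᵇ dst in e3
  ... | true = trans (cong (_+ v) (trans (setReg-same dst _ R1) (cong suc R1d))) (sym (+-suc (R dst) v))
  ... | false = refl

move2Code : ℕ → ℕ → ℕ → ℕ → List Instr
move2Code src d1 d2 b = decjz src (4 + b) ∷ inc d1 ∷ inc d2 ∷ jmp b ∷ []

move2-spec : ∀ {P X} src d1 d2 b → Loaded P b (move2Code src d1 d2 b) → d1 ≠ᵇ src → d2 ≠ᵇ src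
  → d1 ≠ᵇ d2
  → 4 ≠ᵇ src → 4 ≠ᵇ d1 → 4 ≠ᵇ d2 → ∀ v R → R src ≡ v → R 4 ≡ 0
  → Reach P X b R (4 + b) (setReg src 0 (setReg d1 (R d1 + v) (setReg d2 (R d2 + v) R)))
move2-spec src d1 d2 b h n1 n2 n12 n4s n41 n42 zero R e z = reach-regs ext (step-jz (h 0 _ refl) e)
  where
  ext : R ≗ setReg src 0 (setReg d1 (R d1 + 0) (setReg d2 (R d2 + 0) R))
  ext i with i ≡ᵇ src in e1
  ... | true rewrite ≡ᵇ-true⇒≡ i src e1 = e
  ... | false with i ≡ᵇ d1 in e2
  ... | true rewrite ≡ᵇ-true⇒≡ i d1 e2 = sym (+-identityʳ _)
  ... | false with i ≡ᵇ d2 in e3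
  ... | true rewrite ≡ᵇ-true⇒≡ i d2 e3 = sym (+-identityʳ _)
  ... | false = refl
move2-spec {P} {X} src d1 d2 b h n1 n2 n12 n4s n41 n42 (suc v) R e z =
  step-dec (h 0 _ refl) e ▸ step-inc (h 1 _ refl) ▸ step-inc (h 2 _ refl) ▸ step-jz (h 3 _ refl) z3
  ▸ reach-regs ext (move2-spec src d1 d2 b h n1 n2 n12 n4s n41 n42 v R3 e3 z3)
  where
  R1 = setReg src v R
  R2 = setReg d1 (suc (R1 d1)) R1
  R3 = setReg d2 (suc (R2 d2)) R2
  z3 : R3 4 ≡ 0
  z3 = trans (setReg-other d2 _ R2 4 n42) (trans (setReg-other d1 _ R1 4 n41) (trans (setReg-other src v R 4 n4s) z))
  e3 : R3 src ≡ v
  e3 = trans (setReg-other d2 _ R2 src (trans (≡ᵇ-sym src d2) n2)) (trans (setReg-other d1 _ R1 src (trans (≡ᵇ-sym src d1) n1)) (setReg-same src v R))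
  R3d1 : R3 d1 ≡ suc (R d1)
  R3d1 = trans (setReg-other d2 _ R2 d1 n12) (trans (setReg-same d1 _ R1) (cong suc (setReg-other src v R d1 n1)))
  R3d2 : R3 d2 ≡ suc (R d2)
  R3d2 = trans (setReg-same d2 _ R2) (cong suc (trans (setReg-other d1 _ R1 d2 (trans (≡ᵇ-sym d2 d1) n12)) (setReg-other src v R d2 n2)))
  ext : setReg src 0 (setReg d1 (R3 d1 + v) (setReg d2 (R3 d2 + v) R3)) ≗ setReg src 0 (setReg d1 (R d1 + suc v) (setReg d2 (R d2 + suc v) R))
  ext i with i ≡ᵇ src in e1
  ... | true = refl
  ... | false with i ≡ᵇ d1 in e2
  ... | true = trans (cong (_+ v) R3d1) (sym (+-suc (R d1) v))
  ... | false with i ≡ᵇ d2 in e4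
  ... | true = trans (cong (_+ v) R3d2) (sym (+-suc (R d2) v))
  ... | false = refl

copyCode : ℕ → ℕ → ℕ → ℕ → List Instr
copyCode src dst tmp b = clearCode dst b ++ clearCode tmp (2 + b) ++ move2Code src dst tmp (4 + b) ++ moveCode tmp src (8 + b)

copy-spec : ∀ {P X} src dst tmp b → Loaded P b (copyCode src dst tmp b)
  → dst ≠ᵇ src → tmp ≠ᵇ src → dst ≠ᵇ tmp
  → 4 ≠ᵇ src → 4 ≠ᵇ dst → 4 ≠ᵇ tmp → ∀ R → R 4 ≡ 0
  → Reach P X b R (11 + b) (setReg tmp 0 (setReg dst (R src) R))
copy-spec {P} {X} src dst tmp b h nds nts ndt n4s n4d n4t R z =
  clear-spec dst b h1 n4d (R dst) R refl z
  ▸ clear-spec tmp (2 + b) h2 n4t (R1 tmp) R1 refl z1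
  ▸ move2-spec src dst tmp (4 + b) h3 nds nts ndt n4s n4d n4t (R src) R2 e2 z2
  ▸ reach-regs ext (move-spec tmp src (8 + b) h4 nst n4t n4s (R3 tmp) R3 refl z3)
  where
  B2 = clearCode tmp (2 + b) ++ move2Code src dst tmp (4 + b) ++ moveCode tmp src (8 + b)
  B3 = move2Code src dst tmp (4 + b) ++ moveCode tmp src (8 + b)
  h1 = loaded-++ˡ {P} {b} (clearCode dst b) B2 h
  h2' = loaded-++ʳ {P} {b} (clearCode dst b) B2 h
  h2 = loaded-++ˡ {P} {2 + b} (clearCode tmp (2 + b)) B3 h2'
  h3' = loaded-++ʳ {P} {2 + b} (clearCode tmp (2 + b)) B3 h2'
  h3 = loaded-++ˡ {P} {4 + b} (move2Code src dst tmp (4 + b)) (moveCode tmp src (8 + b)) h3'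
  h4 = loaded-++ʳ {P} {4 + b} (move2Code src dst tmp (4 + b)) (moveCode tmp src (8 + b)) h3'
  nst : src ≠ᵇ tmp
  nst = trans (≡ᵇ-sym src tmp) nts
  nsd : src ≠ᵇ dst
  nsd = trans (≡ᵇ-sym src dst) nds
  ntd : tmp ≠ᵇ dst
  ntd = trans (≡ᵇ-sym tmp dst) ndt
  R1 = setReg dst 0 R
  R2 = setReg tmp 0 R1
  R3a = setReg tmp (R2 tmp + R src) R2
  R3b = setReg dst (R2 dst + R src) R3a
  R3 = setReg src 0 R3b
  z1 : R1 4 ≡ 0
  z1 = trans (setReg-other dst 0 R 4 n4d) z
  z2 : R2 4 ≡ 0
  z2 = trans (setReg-other tmp 0 R1 4 n4t) z1
  z3 : R3 4 ≡ 0
  z3 = trans (setReg-other src 0 R3b 4 n4s) (trans (setReg-other dst _ R3a 4 n4d) (trans (setReg-other tmp _ R2 4 n4t) z2))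
  e2 : R2 src ≡ R src
  e2 = trans (setReg-other tmp 0 R1 src nst) (setReg-other dst 0 R src nsd)
  R2t : R2 tmp ≡ 0
  R2t = setReg-same tmp 0 R1
  R2d : R2 dst ≡ 0
  R2d = trans (setReg-other tmp 0 R1 dst ndt) (setReg-same dst 0 R)
  R3s : R3 src ≡ 0
  R3s = setReg-same src 0 R3b
  R3t : R3 tmp ≡ R src
  R3t = trans (setReg-other src 0 R3b tmp nts) (trans (setReg-other dst _ R3a tmp ntd) (trans (setReg-same tmp _ R2) (cong (_+ R src) R2t)))
  ext : setReg tmp 0 (setReg src (R3 src + R3 tmp) R3) ≗ setReg tmp 0 (setReg dst (R src) R)
  ext i with i ≡ᵇ tmp in e1
  ... | true = refl
  ... | false with i ≡ᵇ src in e3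
  ... | true with i ≡ᵇ dst in e4
  ...   | true = ⊥-elim (≡ᵇ-distinct i src dst e3 e4 nsd)
  ...   | false = trans (cong₂ _+_ R3s R3t) (cong R (sym (≡ᵇ-true⇒≡ i src e3)))
  ext i | false | false with i ≡ᵇ dst in e4
  ... | true = trans (cong (_+ R src) R2d) refl
  ... | false = refl

-- Pairing.  `unpair c` is the c-th pair in the enumeration
-- (0,0), (1,0), (0,1), (2,0), (1,1), (0,2), … along the anti-diagonals,
-- obtained by c applications of `nextPair` to (0,0).
nextPair : ℕ × ℕ → ℕ × ℕ
nextPair (zero , y) = (suc y , 0)
nextPair (suc x , y) = (x , suc y)

iterPair : ℕ → ℕ × ℕ → ℕ × ℕ
iterPair zero p = p
iterPair (suc c) p = iterPair c (nextPair p)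

unpair : ℕ → ℕ × ℕ
unpair c = iterPair c (0 , 0)

iterPair-suc : ∀ c p → iterPair (suc c) p ≡ nextPair (iterPair c p)
iterPair-suc zero p = refl
iterPair-suc (suc c) p = iterPair-suc c (nextPair p)

diagonal : ∀ s y → y ≤ s → Σ ℕ λ c → unpair c ≡ (s ∸ y , y) × y ≤ c
diagonal zero zero le = 0 , refl , z≤n
diagonal (suc s) zero le with diagonal s s ≤-refl
... | c , e , _ = suc c , trans (iterPair-suc c (0 , 0)) (trans (cong nextPair e) (cong (λ z → nextPair (z , s)) (n∸n≡0 s))) , z≤n
diagonal s (suc y) le with diagonal s y (≤-trans (n≤1+n y) le)
... | c , e , le' = suc c , trans (iterPair-suc c (0 , 0)) (trans (cong nextPair e) (cong (λ z → nextPair (z , y)) (∸-suc s y le))) , s≤s le'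
  where
  ∸-suc : ∀ s y → y < s → s ∸ y ≡ suc (s ∸ suc y)
  ∸-suc (suc s) zero lt = refl
  ∸-suc (suc s) (suc y) (s≤s lt) = ∸-suc s y lt

pair : ∀ x y → Σ ℕ λ c → unpair c ≡ (x , y) × y ≤ c
pair x y with diagonal (x + y) y (m≤n+m y x)
... | c , e , le = c , trans e (cong (_, y) (m+n∸n≡m x y)) , le

-- A number j codes the infinite sequence `offset j`: its head is the first
-- component of `unpair j` and its tail is coded by the second component.
tails : ℕ → ℕ → ℕ
tails zero c = c
tails (suc i) c = tails i (proj₂ (unpair c))

offset : ℕ → ℕ → ℕ
offset j i = proj₁ (unpair (tails i j))

offset-onto : ∀ B (w : ℕ → ℕ) z → Σ ℕ λ c → (∀ i → i < B → offset c i ≡ w i) × z ≤ c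
offset-onto zero w z = z , (λ i ()) , ≤-refl
offset-onto (suc B) w z with offset-onto B (λ i → w (suc i)) z
... | c' , f , le' with pair (w 0) c'
...   | c , e , le = c , g , ≤-trans le' le
  where
  g : ∀ i → i < suc B → offset c i ≡ w i
  g zero lt = cong proj₁ e
  g (suc i) (s≤s lt) = trans (cong (λ p → offset (proj₂ p) i) e) (f i lt)

-- Machine code for decoding.  The unpairing loop works on registers
-- 7 (counter c), 8 and 9 (the current pair), stepping the pair c times.
unpairLoopCode : ℕ → List Instr
unpairLoopCode b = decjz 7 (9 + b) ∷ decjz 8 (4 + b) ∷ inc 9 ∷ jmp b ∷ moveCode 9 8 (4 + b) ++ (inc 8 ∷ jmp b ∷ [])

withPair : ℕ × ℕ → Regs → Regs
withPair p R = setReg 7 0 (setReg 8 (proj₁ p) (setReg 9 (proj₂ p) R))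

unpairLoop-spec : ∀ {P X} b → Loaded P b (unpairLoopCode b) → ∀ c R → R 7 ≡ c → R 4 ≡ 0
  → Reach P X b R (9 + b) (withPair (iterPair c (R 8 , R 9)) R)
unpairLoop-spec b h zero R e z =
  reach-regs (byRegister _ refl refl refl refl refl refl refl e refl refl (λ k → refl)) (step-jz (h 0 _ refl) e)
unpairLoop-spec {P} {X} b h (suc c) R e z with R 8 in e8
... | suc x =
  step-dec (h 0 _ refl) e ▸ step-dec (h 1 _ refl) e8 ▸ step-inc (h 2 _ refl) ▸ step-jz (h 3 _ refl) z
  ▸ reach-regs (byRegister _ refl refl refl refl refl refl refl refl refl refl (λ k → refl)) (unpairLoop-spec b h c R3 refl z)
  where
  R1 = setReg 7 c R
  R2 = setReg 8 x R1
  R3 = setReg 9 (suc (R2 9)) R2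
... | zero =
  step-dec (h 0 _ refl) e ▸ step-jz (h 1 _ refl) e8
  ▸ reach-regs moved (move-spec 9 8 (4 + b) h4 refl refl refl (R 9) R1 refl z)
  ▸ step-inc (h 7 _ refl) ▸ step-jz (h 8 _ refl) z
  ▸ reach-regs (byRegister _ refl refl refl refl refl refl refl refl refl refl (λ k → refl)) (unpairLoop-spec b h c R3 refl z)
  where
  R1 = setReg 7 c R
  R2 = setReg 9 0 (setReg 8 (R 9) R1)
  moved : setReg 9 0 (setReg 8 (R1 8 + R 9) R1) ≗ R2
  moved = byRegister _ refl refl refl refl refl refl refl refl (cong (_+ R 9) e8) refl (λ k → refl)
  R3 = setReg 8 (suc (R2 8)) R2
  h4 : Loaded P (4 + b) (moveCode 9 8 (4 + b))
  h4 = loaded-++ˡ {P} {4 + b} (moveCode 9 8 (4 + b)) (inc 8 ∷ jmp b ∷ [])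
         (loaded-++ʳ {P} {b} (decjz 7 (9 + b) ∷ decjz 8 (4 + b) ∷ inc 9 ∷ jmp b ∷ []) _ h)

unpairCode : ℕ → List Instr
unpairCode b = clearCode 8 b ++ clearCode 9 (2 + b) ++ unpairLoopCode (4 + b)

unpair-spec : ∀ {P X} b → Loaded P b (unpairCode b) → ∀ R → R 4 ≡ 0
  → Reach P X b R (13 + b) (withPair (unpair (R 7)) R)
unpair-spec {P} {X} b h R z =
  clear-spec 8 b h1 refl (R 8) R refl z
  ▸ clear-spec 9 (2 + b) h2 refl (R1 9) R1 refl z
  ▸ reach-regs (byRegister _ refl refl refl refl refl refl refl refl refl refl (λ k → refl)) (unpairLoop-spec (4 + b) h3 (R 7) R2 refl z)
  where
  R1 = setReg 8 0 R
  R2 = setReg 9 0 R1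
  h1 = loaded-++ˡ {P} {b} (clearCode 8 b) _ h
  h2' = loaded-++ʳ {P} {b} (clearCode 8 b) (clearCode 9 (2 + b) ++ unpairLoopCode (4 + b)) h
  h2 = loaded-++ˡ {P} {2 + b} (clearCode 9 (2 + b)) _ h2'
  h3 = loaded-++ʳ {P} {2 + b} (clearCode 9 (2 + b)) (unpairLoopCode (4 + b)) h2'

tailCode : ℕ → List Instr
tailCode b = decjz 6 (18 + b) ∷ (unpairCode (1 + b) ++ moveCode 9 7 (14 + b) ++ jmp b ∷ [])

tailRegs : ℕ → ℕ → ℕ → Regs → Regs
tailRegs c a y R = setReg 6 0 (setReg 7 c (setReg 8 a (setReg 9 y R)))

tailRound : ℕ → Regs → Regs
tailRound i R = setReg 9 0 (setReg 7 (R2 7 + R2 9) R2)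
  where R2 = withPair (unpair (R 7)) (setReg 6 i R)

tail-spec : ∀ {P X} b → Loaded P b (tailCode b) → ∀ i R → R 6 ≡ i → R 4 ≡ 0
  → Σ ℕ λ a → Σ ℕ λ y → Reach P X b R (18 + b) (tailRegs (tails i (R 7)) a y R)
tail-spec b h zero R e z =
  R 8 , R 9 , reach-regs (byRegister _ refl refl refl refl refl refl e refl refl refl (λ k → refl)) (step-jz (h 0 _ refl) e)
tail-spec {P} {X} b h (suc i) R e z with tail-spec b h i (tailRound i R) refl z
... | a , y , r = a , y ,
  (step-dec (h 0 _ refl) e ▸ unpair-spec (1 + b) hU R1 z ▸ move-spec 9 7 (14 + b) hM refl refl refl _ R2 refl z
   ▸ step-jz (h 17 _ refl) z ▸ reach-regs (byRegister _ refl refl refl refl refl refl refl refl refl refl (λ k → refl)) r)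
  where
  R1 = setReg 6 i R
  R2 = withPair (unpair (R 7)) R1
  hT = loaded-++ʳ {P} {b} (decjz 6 (18 + b) ∷ []) (unpairCode (1 + b) ++ moveCode 9 7 (14 + b) ++ jmp b ∷ []) h
  hU = loaded-++ˡ {P} {1 + b} (unpairCode (1 + b)) _ hT
  hM = loaded-++ˡ {P} {14 + b} (moveCode 9 7 (14 + b))  _
         (loaded-++ʳ {P} {1 + b} (unpairCode (1 + b)) (moveCode 9 7 (14 + b) ++ jmp b ∷ []) hT)

-- With the attempt number j
-- in register 2 and q = R (10 + s), it sets R (10 + d) := X q + offset j q,
-- i.e. it queries the modified oracle X + offset j.
queryCode : ℕ → ℕ → ℕ → List Instr
queryCode s d b = copyCode (10 + s) 6 5 b ++ copyCode 2 7 5 (11 + b) ++ tailCode (22 + b) ++ unpairCode (40 + b)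
  ++ orc (10 + d) (10 + s) ∷ moveCode 8 (10 + d) (54 + b)

queryRegs : ℕ → ℕ → Regs → Regs
queryRegs a y Q = setReg 5 0 (setReg 6 0 (setReg 7 0 (setReg 8 a (setReg 9 y Q))))

query-spec : ∀ {P X} s d b → Loaded P b (queryCode s d b) → ∀ R → R 4 ≡ 0
  → Σ ℕ λ y → Reach P X b R (57 + b) (queryRegs 0 y (setReg (10 + d) (X (R (10 + s)) + offset (R 2) (R (10 + s))) R))
query-spec {P} {X} s d b h R z = proj₂ (unpair (tails (R (10 + s)) (R 2))) ,
  (copy-spec (10 + s) 6 5 b hC1 refl refl refl refl refl refl R z
  ▸ copy-spec 2 7 5 (11 + b) hC2 refl refl refl refl refl refl _ z
  ▸ proj₂ (proj₂ O) ▸ unpair-spec (40 + b) hU _ z ▸ step-orc hOrc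
  ▸ reach-regs (byRegister _ refl refl refl refl refl refl refl refl refl refl (λ k → refl))
      (reach-regs (setReg-cong 8 0 (setReg-add R4 D (X (R4 S)) (R4 8)))
        (move-spec 8 (10 + d) (54 + b) hMv refl refl refl _ _ refl z)))
  where
  S = 10 + s
  D = 10 + d
  B1 = copyCode 2 7 5 (11 + b) ++ tailCode (22 + b) ++ unpairCode (40 + b) ++ orc D S ∷ moveCode 8 D (54 + b)
  B2 = tailCode (22 + b) ++ unpairCode (40 + b) ++ orc D S ∷ moveCode 8 D (54 + b)
  B3 = unpairCode (40 + b) ++ orc D S ∷ moveCode 8 D (54 + b)
  B4 = orc D S ∷ moveCode 8 D (54 + b)
  hC1 = loaded-++ˡ {P} {b} (copyCode S 6 5 b) B1 h
  h1 = loaded-++ʳ {P} {b} (copyCode S 6 5 b) B1 h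
  hC2 = loaded-++ˡ {P} {11 + b} (copyCode 2 7 5 (11 + b)) B2 h1
  h2 = loaded-++ʳ {P} {11 + b} (copyCode 2 7 5 (11 + b)) B2 h1
  hO = loaded-++ˡ {P} {22 + b} (tailCode (22 + b)) B3 h2
  h3 = loaded-++ʳ {P} {22 + b} (tailCode (22 + b)) B3 h2
  hU = loaded-++ˡ {P} {40 + b} (unpairCode (40 + b)) B4 h3
  h4 = loaded-++ʳ {P} {40 + b} (unpairCode (40 + b)) B4 h3
  O = tail-spec {P} {X} (22 + b) hO (R S) (setReg 5 0 (setReg 7 (R 2) (setReg 5 0 (setReg 6 (R S) R)))) refl z
  R1 = setReg 5 0 (setReg 6 (R S) R)
  R2 = setReg 5 0 (setReg 7 (R 2) R1)
  R3 = tailRegs (tails (R S) (R2 7)) (proj₁ O) (proj₁ (proj₂ O)) R2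
  R4 = withPair (unpair (R3 7)) R3
  hOrc : nth P (53 + b) ≡ just (orc D S)
  hOrc = h4 0 _ refl
  hMv = loaded-++ʳ {P} {53 + b} (orc D S ∷ []) (moveCode 8 D (54 + b)) h4

clearSimCode : ℕ → ℕ → List Instr
clearSimCode zero b = []
clearSimCode (suc k) b = clearCode (10 + k) b ++ clearSimCode k (2 + b)

clearSim : ℕ → Regs → Regs
clearSim zero R = R
clearSim (suc k) R = clearSim k (setReg (10 + k) 0 R)

clearSim-spec : ∀ {P X} k b → Loaded P b (clearSimCode k b) → ∀ R → R 4 ≡ 0
  → Reach P X b R (length (clearSimCode k b) + b) (clearSim k R)
clearSim-spec zero b h R z = reach-refl
clearSim-spec {P} {X} (suc k) b h R z =
  clear-spec (10 + k) b (loaded-++ˡ {P} {b} (clearCode (10 + k) b) _ h) refl (R (10 + k)) R refl z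
  ▸ reach-pc (trans (+-suc L (suc b)) (cong suc (+-suc L b)))
      (clearSim-spec k (2 + b) (loaded-++ʳ {P} {b} (clearCode (10 + k) b) _ h) (setReg (10 + k) 0 R) z)
  where L = length (clearSimCode k (2 + b))

clearSim-low : ∀ k R i → i < 10 → clearSim k R i ≡ R i
clearSim-low zero R i lt = refl
clearSim-low (suc k) R i lt =
  trans (clearSim-low k _ i lt) (setReg-other (10 + k) 0 R i (≢⇒≠ᵇ i (10 + k) (<⇒≢ (≤-trans lt (m≤m+n 10 k)))))

clearSim-above : ∀ k R r → k ≤ r → clearSim k R (10 + r) ≡ R (10 + r)
clearSim-above zero R r le = refl
clearSim-above (suc k) R r le =
  trans (clearSim-above k _ r (≤-trans (n≤1+n k) le)) (setReg-other (10 + k) 0 R (10 + r) (≢⇒≠ᵇ r k (λ e → <⇒≢ le (sym e))))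

clearSim-cleared : ∀ k R r → r < k → clearSim k R (10 + r) ≡ 0
clearSim-cleared (suc k) R r lt with m<1+n⇒m<n∨m≡n lt
... | inj₁ lt' = clearSim-cleared k _ r lt'
... | inj₂ refl = trans (clearSim-above r _ r ≤-refl) (setReg-same (10 + r) 0 R)

≫-trans : ∀ {f g h : ℕ → ℕ} → g ≫ f → h ≫ g → h ≫ f
≫-trans g≫f h≫g i = ≤-trans (g≫f i) (h≫g i)

-- The oracle X shifted up by the sequence coded by j.  Attempt j of ψ runs φ
-- with this oracle.
shifted : (ℕ → ℕ) → ℕ → ℕ → ℕ
shifted X j i = X i + offset j i

maxRegI : Instr → ℕ
maxRegI (inc r) = r
maxRegI (decjz r l) = r
maxRegI (orc d s) = d ⊔ s

maxReg : Functional → ℕ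
maxReg [] = 0
maxReg (x ∷ xs) = maxRegI x ⊔ maxReg xs

maxReg-nth : ∀ xs p {x} → nth xs p ≡ just x → maxRegI x ≤ maxReg xs
maxReg-nth (y ∷ xs) zero refl = m≤m⊔n (maxRegI y) (maxReg xs)
maxReg-nth (y ∷ xs) (suc p) e = ≤-trans (maxReg-nth xs p e) (m≤n⊔m (maxRegI y) (maxReg xs))

-- Each instruction of φ is compiled to a block of exactly `blockSize`
-- instructions, so that the block of instruction p starts at a computable address.
blockSize : ℕ
blockSize = 59

shift-by-row : ∀ a b q → a + (b + a * q) ≡ b + a * suc q
shift-by-row a b q = begin
  a + (b + a * q)  ≡⟨ sym (+-assoc a b (a * q)) ⟩
  a + b + a * q    ≡⟨ cong (_+ a * q) (+-comm a b) ⟩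
  b + a + a * q    ≡⟨ +-assoc b a (a * q) ⟩
  b + (a + a * q)  ≡⟨ cong (b +_) (sym (*-suc a q)) ⟩
  b + a * suc q    ∎
  where open ≡-Reasoning

padding : List Instr
padding = replicate 56 (inc 9)

isOne : Maybe ℕ → Bool
isOne (just (suc zero)) = true
isOne _ = false

isOne-true : ∀ v → isOne v ≡ true → v ≡ just 1
isOne-true (just (suc zero)) e = refl
isOne-true nothing ()
isOne-true (just zero) ()
isOne-true (just (suc (suc x))) ()

-- Registers of ψ: 0 input and output,
-- 1 the input n, 2 the attempt number j, 3 the fuel left in the attempt,
-- 4 constantly 0, 5…9 scratch, 10 + r the register r of the simulated φ.
-- Code layout:
--   prologue  (address 0)          R 1 := n
--   setup     (address 3)          clear simulated registers, R 10 := n, R 3 := j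
--   body      (address bodyAddr)   one block per instruction of φ; each block
--                                  first spends one unit of fuel, jumping to
--                                  reject when there is none
--   verdict   (address verdictAddr) the simulated φ halted: accept iff it output 1
--   reject    (address rejectAddr)  R 2 := R 2 + 1, go to setup
--   accept    (address acceptAddr)  R 0 := 1, halt
module Build (φ : Functional) where
  width : ℕ
  width = suc (maxReg φ)

  progLen : ℕ
  progLen = length φ

  prologue : List Instr
  prologue = moveCode 0 1 0

  clearPart : List Instr
  clearPart = clearSimCode width 3

  setup : List Instr
  setup = clearPart ++ copyCode 1 10 5 (length clearPart + 3) ++ copyCode 2 3 5 (11 + (length clearPart + 3))

  bodyAddr verdictAddr rejectAddr acceptAddr : ℕ
  bodyAddr = length setup + 3
  verdictAddr = bodyAddr + blockSize * progLen
  rejectAddr = 4 + verdictAddr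
  acceptAddr = 6 + verdictAddr

  addr : ℕ → ℕ
  addr p = bodyAddr + blockSize * p

  -- Jumps of φ beyond its end all go to the verdict.
  target : ℕ → ℕ
  target l = addr (l ⊓ progLen)

  block : ℕ → Instr → List Instr
  block p (inc r) = decjz 3 rejectAddr ∷ inc (10 + r) ∷ jmp (addr (suc p)) ∷ padding
  block p (decjz r l) = decjz 3 rejectAddr ∷ decjz (10 + r) (target l) ∷ jmp (addr (suc p)) ∷ padding
  block p (orc d s) = decjz 3 rejectAddr ∷ (queryCode s d (1 + addr p) ++ jmp (addr (suc p)) ∷ [])

  compileFrom : ℕ → List Instr → List Instr
  compileFrom p [] = []
  compileFrom p (x ∷ xs) = block p x ++ compileFrom (suc p) xs

  verdict reject accept : List Instr
  verdict = decjz 3 rejectAddr ∷ decjz 10 rejectAddr ∷ decjz 10 acceptAddr ∷ jmp rejectAddr ∷ []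
  reject = inc 2 ∷ jmp 3 ∷ []
  accept = inc 0 ∷ []

  ψ : Functional
  ψ = prologue ++ setup ++ compileFrom 0 φ ++ verdict ++ reject ++ accept

  block-length : ∀ p x → length (block p x) ≡ blockSize
  block-length p (inc r) = refl
  block-length p (decjz r l) = refl
  block-length p (orc d s) = refl

  compileFrom-length : ∀ q xs → length (compileFrom q xs) ≡ blockSize * length xs
  compileFrom-length q [] = sym (*-zeroʳ blockSize)
  compileFrom-length q (x ∷ xs) = begin
    length (block q x ++ compileFrom (suc q) xs)            ≡⟨ length-++ (block q x) ⟩
    length (block q x) + length (compileFrom (suc q) xs)  ≡⟨ cong₂ _+_ (block-length q x) (compileFrom-length (suc q) xs) ⟩
    blockSize + blockSize * length xs                      ≡⟨ sym (*-suc blockSize (length xs)) ⟩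
    blockSize * length (x ∷ xs)                            ∎
    where open ≡-Reasoning

  addr-suc : ∀ q → blockSize + addr q ≡ addr (suc q)
  addr-suc q = shift-by-row blockSize bodyAddr q

  suffix-setup : SuffixAt ψ 3 (setup ++ compileFrom 0 φ ++ verdict ++ reject ++ accept)
  suffix-setup = suffix-++ʳ {ψ} {0} prologue _ (suffix-self ψ)

  suffix-body : SuffixAt ψ bodyAddr (compileFrom 0 φ ++ verdict ++ reject ++ accept)
  suffix-body = suffix-++ʳ {ψ} {3} setup _ suffix-setup

  suffix-verdict : SuffixAt ψ verdictAddr (verdict ++ reject ++ accept)
  suffix-verdict = suffix-at {ψ} {_} {verdictAddr} {verdict ++ reject ++ accept}
    (trans (cong (_+ bodyAddr) (compileFrom-length 0 φ)) (+-comm (blockSize * progLen) bodyAddr))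
    (suffix-++ʳ {ψ} {bodyAddr} (compileFrom 0 φ) (verdict ++ reject ++ accept) suffix-body)

  suffix-reject : SuffixAt ψ rejectAddr (reject ++ accept)
  suffix-reject = suffix-++ʳ {ψ} {verdictAddr} verdict (reject ++ accept) suffix-verdict

  suffix-accept : SuffixAt ψ acceptAddr accept
  suffix-accept = suffix-++ʳ {ψ} {rejectAddr} reject accept suffix-reject

  prologue-loaded : Loaded ψ 0 prologue
  prologue-loaded = loaded-++ˡ {ψ} {0} prologue _ (suffix⇒loaded {ψ} {0} {ψ} (suffix-self ψ))

  setup-loaded : Loaded ψ 3 setup
  setup-loaded = loaded-++ˡ {ψ} {3} setup _ (suffix⇒loaded {ψ} {3} {setup ++ compileFrom 0 φ ++ verdict ++ reject ++ accept} suffix-setup)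

  verdict-loaded : Loaded ψ verdictAddr verdict
  verdict-loaded = loaded-++ˡ {ψ} {verdictAddr} verdict (reject ++ accept) (suffix⇒loaded {ψ} {verdictAddr} {verdict ++ reject ++ accept} suffix-verdict)

  reject-loaded : Loaded ψ rejectAddr reject
  reject-loaded = loaded-++ˡ {ψ} {rejectAddr} reject accept (suffix⇒loaded {ψ} {rejectAddr} {reject ++ accept} suffix-reject)

  compileFrom-loaded : ∀ q xs i {x} → Loaded ψ (addr q) (compileFrom q xs) → nth xs i ≡ just x
    → Loaded ψ (addr (i + q)) (block (i + q) x)
  compileFrom-loaded q (y ∷ xs) zero h refl = loaded-++ˡ {ψ} {addr q} (block q y) _ h
  compileFrom-loaded q (y ∷ xs) (suc i) {x} h e =
    subst (λ z → Loaded ψ (addr z) (block z x)) (+-suc i q) (compileFrom-loaded (suc q) xs i rest e)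
    where
    rest : Loaded ψ (addr (suc q)) (compileFrom (suc q) xs)
    rest = loaded-at {ψ} {_} {_} {compileFrom (suc q) xs}
      (trans (cong (_+ addr q) (block-length q y)) (addr-suc q))
      (loaded-++ʳ {ψ} {addr q} (block q y) (compileFrom (suc q) xs) h)

  block-loaded : ∀ p {x} → nth φ p ≡ just x → Loaded ψ (addr p) (block p x)
  block-loaded p {x} e = subst (λ z → Loaded ψ (addr z) (block z x)) (+-identityʳ p)
    (compileFrom-loaded 0 φ p (loaded-at {ψ} {_} {_} {compileFrom 0 φ} (sym (+-identityʳ bodyAddr)) body) e)
    where
    body : Loaded ψ bodyAddr (compileFrom 0 φ)
    body = loaded-++ˡ {ψ} {bodyAddr} (compileFrom 0 φ) _
             (suffix⇒loaded {ψ} {bodyAddr} {compileFrom 0 φ ++ verdict ++ reject ++ accept} suffix-body)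

  block-fuel-check : ∀ p x → nth (block p x) 0 ≡ just (decjz 3 rejectAddr)
  block-fuel-check p (inc r) = refl
  block-fuel-check p (decjz r l) = refl
  block-fuel-check p (orc d s) = refl

  Invariant : ℕ → ℕ → Regs → Set
  Invariant n j R = R 0 ≡ 0 × R 1 ≡ n × R 2 ≡ j × R 4 ≡ 0

  exitAddr : Maybe ℕ → ℕ
  exitAddr v = if isOne v then acceptAddr else rejectAddr

  reg4 : ∀ {n j} R → Invariant n j R → R 4 ≡ 0
  reg4 R (_ , _ , _ , z) = z

  module Attempt (X : ℕ → ℕ) (n j : ℕ) where
    Simulates : Regs → Regs → Set
    Simulates R R' = ∀ r → r < width → R' (10 + r) ≡ R r

    EndsWith : ℕ → Regs → Maybe ℕ → Set
    EndsWith pc R' v = Σ Regs λ R'' → Reach ψ X pc R' (exitAddr v) R'' × Invariant n j R''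

    endsWith-result : ∀ {pc R' a b} → a ≡ b → EndsWith pc R' b → EndsWith pc R' a
    endsWith-result refl r = r

    mutual
      simulate : ∀ t p R R' → p ≤ progLen → Simulates R R' → R' 3 ≡ t → Invariant n j R'
        → EndsWith (addr p) R' (run φ (shifted X j) t p R)
      simulate t p R R' le sm e3 inv with m≤n⇒m<n∨m≡n le
      ... | inj₂ refl = simulate-verdict t R R' sm e3 inv
      ... | inj₁ lt with nth-defined φ p lt
      ...   | ins , eq = simulate-block t p ins eq R R' lt sm e3 inv

      simulate-verdict : ∀ t R R' → Simulates R R' → R' 3 ≡ t → Invariant n j R'
        → EndsWith verdictAddr R' (run φ (shifted X j) t progLen R)
      simulate-verdict zero R R' sm e3 inv = R' , step-jz (verdict-loaded 0 _ refl) e3 , inv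
      simulate-verdict (suc t) R R' sm e3 inv =
        endsWith-result (cong (exec φ (shifted X j) t progLen R) (nth-past-end φ progLen ≤-refl)) (output (R 0) refl)
        where
        h = verdict-loaded
        output : ∀ v → R 0 ≡ v → EndsWith verdictAddr R' (just v)
        output zero e0 = _ , (step-dec (h 0 _ refl) e3 ▸ step-jz (h 1 _ refl) (trans (sm 0 (s≤s z≤n)) e0)) , inv
        output (suc zero) e0 =
          _ , (step-dec (h 0 _ refl) e3 ▸ step-dec (h 1 _ refl) (trans (sm 0 (s≤s z≤n)) e0) ▸ step-jz (h 2 _ refl) refl) , inv
        output (suc (suc w)) e0 =
          _ , (step-dec (h 0 _ refl) e3 ▸ step-dec (h 1 _ refl) (trans (sm 0 (s≤s z≤n)) e0) ▸ step-dec (h 2 _ refl) refl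
               ▸ step-jz (h 3 _ refl) (reg4 R' inv)) , inv

      simulate-block : ∀ t p ins → nth φ p ≡ just ins → ∀ R R' → p < progLen → Simulates R R' → R' 3 ≡ t
        → Invariant n j R' → EndsWith (addr p) R' (run φ (shifted X j) t p R)
      simulate-block zero p ins eq R R' lt sm e3 inv = R' , step-jz (block-loaded p eq 0 _ (block-fuel-check p ins)) e3 , inv
      simulate-block (suc t) p (inc r) eq R R' lt sm e3 inv =
        endsWith-result (cong (exec φ (shifted X j) t p R) eq) (simulate-inc t p r eq R R' lt sm e3 inv)
      simulate-block (suc t) p (decjz r l) eq R R' lt sm e3 inv =
        endsWith-result (cong (exec φ (shifted X j) t p R) eq) (simulate-decjz t p r l eq R R' lt sm e3 inv (R r) refl)
      simulate-block (suc t) p (orc d s) eq R R' lt sm e3 inv =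
        endsWith-result (cong (exec φ (shifted X j) t p R) eq) (simulate-orc t p d s eq R R' lt sm e3 inv)

      simulate-inc : ∀ t p r → nth φ p ≡ just (inc r) → ∀ R R' → p < progLen → Simulates R R' → R' 3 ≡ suc t
        → Invariant n j R' → EndsWith (addr p) R' (run φ (shifted X j) t (suc p) (setReg r (suc (R r)) R))
      simulate-inc t p r eq R R' lt sm e3 inv =
        let (R'' , rest , inv'') = simulate t (suc p) (setReg r (suc (R r)) R) R2 lt sm2 refl inv
        in R'' , (step-dec (h 0 _ refl) e3 ▸ step-inc (h 1 _ refl) ▸ step-jz (h 2 _ refl) (reg4 R' inv) ▸ rest) , inv''
        where
        h = block-loaded p eq
        R1 = setReg 3 t R'
        R2 = setReg (10 + r) (suc (R1 (10 + r))) R1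
        sm2 : Simulates (setReg r (suc (R r)) R) R2
        sm2 r' lt' with r' ≡ᵇ r
        ... | true = cong suc (sm r (s≤s (maxReg-nth φ p eq)))
        ... | false = sm r' lt'

      simulate-decjz : ∀ t p r l → nth φ p ≡ just (decjz r l) → ∀ R R' → p < progLen → Simulates R R' → R' 3 ≡ suc t
        → Invariant n j R' → ∀ v → R r ≡ v → EndsWith (addr p) R' (branch φ (shifted X j) t p R r l v)
      simulate-decjz t p r l eq R R' lt sm e3 inv zero e =
        endsWith-result (run-clamp φ (shifted X j) t l R)
          (let (R'' , rest , inv'') = simulate t (l ⊓ progLen) R R1 (m⊓n≤n l progLen) sm refl inv
           in R'' , (step-dec (h 0 _ refl) e3 ▸ step-jz (h 1 _ refl) (trans (sm r rlt) e) ▸ rest) , inv'')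
        where
        h = block-loaded p eq
        R1 = setReg 3 t R'
        rlt : r < width
        rlt = s≤s (maxReg-nth φ p eq)
      simulate-decjz t p r l eq R R' lt sm e3 inv (suc v) e =
        let (R'' , rest , inv'') = simulate t (suc p) (setReg r v R) (setReg (10 + r) v R1) lt sm2 refl inv
        in R'' , (step-dec (h 0 _ refl) e3 ▸ step-dec (h 1 _ refl) (trans (sm r rlt) e) ▸ step-jz (h 2 _ refl) (reg4 R' inv) ▸ rest) , inv''
        where
        h = block-loaded p eq
        R1 = setReg 3 t R'
        rlt : r < width
        rlt = s≤s (maxReg-nth φ p eq)
        sm2 : Simulates (setReg r v R) (setReg (10 + r) v R1)
        sm2 r' lt' with r' ≡ᵇ r
        ... | true = refl
        ... | false = sm r' lt'

      simulate-orc : ∀ t p d s → nth φ p ≡ just (orc d s) → ∀ R R' → p < progLen → Simulates R R' → R' 3 ≡ suc t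
        → Invariant n j R' → EndsWith (addr p) R' (run φ (shifted X j) t (suc p) (setReg d (shifted X j (R s)) R))
      simulate-orc t p d s eq R R' lt sm e3 inv =
        let (R'' , rest , inv'') = simulate t (suc p) (setReg d (shifted X j (R s)) R) R3 lt sm3 refl inv
        in R'' , (step-dec (h 0 _ refl) e3 ▸ proj₂ query ▸ step-jz (h 58 _ refl) (reg4 R' inv) ▸ rest) , inv''
        where
        h = block-loaded p eq
        R1 = setReg 3 t R'
        slt : s < width
        slt = s≤s (≤-trans (m≤n⊔m d s) (maxReg-nth φ p eq))
        query-loaded : Loaded ψ (1 + addr p) (queryCode s d (1 + addr p))
        query-loaded = loaded-++ˡ {ψ} {1 + addr p} (queryCode s d (1 + addr p)) (jmp (addr (suc p)) ∷ [])
          (loaded-++ʳ {ψ} {addr p} (decjz 3 rejectAddr ∷ []) (queryCode s d (1 + addr p) ++ jmp (addr (suc p)) ∷ []) h)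
        query = query-spec {ψ} {X} s d (1 + addr p) query-loaded R1 (reg4 R' inv)
        R3 = queryRegs 0 (proj₁ query) (setReg (10 + d) (X (R1 (10 + s)) + offset (R1 2) (R1 (10 + s))) R1)
        sm3 : Simulates (setReg d (shifted X j (R s)) R) R3
        sm3 r' lt' with r' ≡ᵇ d
        ... | true = cong₂ (λ a b → X a + offset b a) (sm s slt) (proj₁ (proj₂ (proj₂ inv)))
        ... | false = sm r' lt'

    setup-spec : ∀ R → Invariant n j R
      → Σ Regs λ R' → Reach ψ X 3 R bodyAddr R' × Simulates (initRegs n) R' × R' 3 ≡ j × Invariant n j R'
    setup-spec R (f0 , f1 , f2 , f4) =
      R3 , reach-pc setup-end (clearSim-spec width 3 h1 R f4
        ▸ copy-spec 1 10 5 (length clearPart + 3) h2 refl refl refl refl refl refl (clearSim width R) z1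
        ▸ copy-spec 2 3 5 (11 + (length clearPart + 3)) h3 refl refl refl refl refl refl R2 z1)
      , sm , low 2 (s≤s (s≤s (s≤s z≤n))) f2
      , low 0 (s≤s z≤n) f0 , low 1 (s≤s (s≤s z≤n)) f1 , low 2 (s≤s (s≤s (s≤s z≤n))) f2 , z1
      where
      h1 : Loaded ψ 3 clearPart
      h1 = loaded-++ˡ {ψ} {3} clearPart _ setup-loaded
      h2 : Loaded ψ (length clearPart + 3) (copyCode 1 10 5 (length clearPart + 3))
      h2 = loaded-++ˡ {ψ} {length clearPart + 3} (copyCode 1 10 5 (length clearPart + 3)) _
             (loaded-++ʳ {ψ} {3} clearPart _ setup-loaded)
      h3 : Loaded ψ (11 + (length clearPart + 3)) (copyCode 2 3 5 (11 + (length clearPart + 3)))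
      h3 = loaded-++ʳ {ψ} {length clearPart + 3} (copyCode 1 10 5 (length clearPart + 3)) _
             (loaded-++ʳ {ψ} {3} clearPart _ setup-loaded)
      setup-end : 11 + (11 + (length clearPart + 3)) ≡ bodyAddr
      setup-end = trans (sym (+-assoc 22 (length clearPart) 3))
        (cong (_+ 3) (trans (+-comm 22 (length clearPart)) (sym (length-++ clearPart))))
      low : ∀ i {v} → i < 10 → R i ≡ v → clearSim width R i ≡ v
      low i lt e = trans (clearSim-low width R i lt) e
      z1 : clearSim width R 4 ≡ 0
      z1 = low 4 (s≤s (s≤s (s≤s (s≤s (s≤s z≤n))))) f4
      R2 = setReg 5 0 (setReg 10 (clearSim width R 1) (clearSim width R))
      R3 = setReg 5 0 (setReg 3 (R2 2) R2)
      sm : Simulates (initRegs n) R3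
      sm zero lt = low 1 (s≤s (s≤s z≤n)) f1
      sm (suc r) lt = clearSim-cleared width R (suc r) lt

    attempt : ∀ R → Invariant n j R → EndsWith 3 R (run φ (shifted X j) j 0 (initRegs n))
    attempt R inv =
      let (R' , r1 , sm , e3 , inv') = setup-spec R inv
          (R'' , r2 , inv'') = simulate j 0 (initRegs n) R' z≤n sm e3 inv'
      in R'' , (r1 ▸ reach-src (sym (+-identityʳ bodyAddr)) r2) , inv''

  open Attempt using (attempt)

  Accepts : (ℕ → ℕ) → ℕ → ℕ → Set
  Accepts X n j = isOne (run φ (shifted X j) j 0 (initRegs n)) ≡ true

  exit-accept : ∀ {v} → isOne v ≡ true → exitAddr v ≡ acceptAddr
  exit-accept e rewrite e = refl

  exit-reject : ∀ {v} → isOne v ≡ false → exitAddr v ≡ rejectAddr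
  exit-reject e rewrite e = refl

  reject-spec : ∀ X R → R 4 ≡ 0 → Reach ψ X rejectAddr R 3 (setReg 2 (suc (R 2)) R)
  reject-spec X R z = step-inc (reject-loaded 0 _ refl) ▸ step-jz (reject-loaded 1 _ refl) z

  accept-spec : ∀ X R t → run ψ X (2 + t) acceptAddr R ≡ just (suc (R 0))
  accept-spec X R t rewrite suffix-accept 0 | suffix-accept 1 = refl

  prologue-spec : ∀ X n → Σ Regs λ R → Reach ψ X 0 (initRegs n) 3 R × Invariant n 0 R
  prologue-spec X n = _ , move-spec 0 1 0 prologue-loaded refl refl refl n (initRegs n) refl refl , refl , refl , refl , refl

  BeforeAttempt : (ℕ → ℕ) → ℕ → ℕ → Set
  BeforeAttempt X n j = Σ Regs λ R → Reach ψ X 0 (initRegs n) 3 R × Invariant n j R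

  halts-at : ∀ X n j → BeforeAttempt X n j → Accepts X n j → Dom ψ X n
  halts-at X n j (R , r , inv) acc =
    let (R'' , r2 , inv'') = attempt X n j R inv
        (k , f) = r ▸ reach-pc (exit-accept acc) r2
    in 1 , k + 2 , trans (f 2) (trans (accept-spec X R'' 0) (cong (λ z → just (suc z)) (proj₁ inv'')))

  reaches-attempt : ∀ X n j → BeforeAttempt X n j ⊎ Dom ψ X n
  reaches-attempt X n zero = inj₁ (prologue-spec X n)
  reaches-attempt X n (suc j) with reaches-attempt X n j
  ... | inj₂ d = inj₂ d
  ... | inj₁ before with isOne (run φ (shifted X j) j 0 (initRegs n)) in e
  ...   | true = inj₂ (halts-at X n j before e)
  ...   | false =
          let (R , r , _) = before
              (R'' , r2 , (f0 , f1 , f2 , f4)) = attempt X n j R (proj₂ (proj₂ before))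
          in inj₁ (setReg 2 (suc (R'' 2)) R'' , (r ▸ reach-pc (exit-reject e) r2 ▸ reject-spec X R'' f4) , f0 , f1 , cong suc f2 , f4)

  complete : ∀ X n j → Accepts X n j → Dom ψ X n
  complete X n j acc with reaches-attempt X n j
  ... | inj₂ d = d
  ... | inj₁ before = halts-at X n j before acc

  sound-from : ∀ X n B t j R → t < B → Invariant n j R → ∀ {v} → run ψ X t 3 R ≡ just v
    → v ≡ 1 × Σ ℕ (Accepts X n)
  sound-from X n (suc B) t j R (s≤s t≤B) inv {v} e with isOne (run φ (shifted X j) j 0 (initRegs n)) in acc
  ... | true =
        let (R'' , r2 , inv'') = attempt X n j R inv
            (t' , _ , e') = reach-run {ψ} {X} t (reach-pc (exit-accept acc) r2) e
        in trans (sym (run-deterministic ψ X (2 + t') t' acceptAddr R'' (accept-spec X R'' t') e')) (cong suc (proj₁ inv''))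
           , j , acc
  ... | false =
        let (R'' , r2 , (f0 , f1 , f2 , f4)) = attempt X n j R inv
            (t' , t≡ , e') = reach-run {ψ} {X} t (reach-pc (exit-reject acc) r2 ▸ reject-spec X R'' f4) e
        in sound-from X n B t' (suc j) (setReg 2 (suc (R'' 2)) R'') (≤-trans (shorter t≡) t≤B) (f0 , f1 , cong suc f2 , f4) e'
    where
    shorter : ∀ {t' k} → t ≡ (k + 2) + t' → t' < t
    shorter {t'} {k} refl rewrite +-suc k 1 = s≤s (m≤n+m t' (k + 1))

  sound : ∀ X n t {v} → run ψ X t 0 (initRegs n) ≡ just v → v ≡ 1 × Σ ℕ (Accepts X n)
  sound X n t e =
    let (R0 , r0 , inv0) = prologue-spec X n
        (t' , _ , e') = reach-run {ψ} {X} t r0 e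
    in sound-from X n (suc t') t' 0 R0 ≤-refl inv0 e'

  ψ-only-ones : OnlyOutputsOnes ψ
  ψ-only-ones X n v (t , e) = proj₁ (sound X n t e)

  -- If φ^Y(n) = 1 with Y ≫ g, some shift of g agrees with Y on the finitely
  -- many queries of the run, at an attempt number large enough to give the
  -- run enough fuel.
  ψ-halts : ∀ {g Y n} → Y ≫ g → φ ^ Y ⟨ n ⟩≃ 1 → Dom ψ g n
  ψ-halts {g} {Y} {n} Y≫g (t , e) =
    let (B , local) = run-local φ Y t 0 (initRegs n) e
        (c , agree , t≤c) = offset-onto B (λ i → Y i ∸ g i) t
        same : ∀ i → i < B → shifted g c i ≡ Y i
        same i lt = trans (cong (g i +_) (agree i lt)) (m+[n∸m]≡n (Y≫g i))
    in complete g n c (cong isOne (run-mono φ (shifted g c) t c 0 (initRegs n) t≤c (local (shifted g c) same)))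

  ψ-witness : ∀ {X n v} → ψ ^ X ⟨ n ⟩≃ v → Σ (ℕ → ℕ) λ Y → Y ≫ X × φ ^ Y ⟨ n ⟩≃ 1
  ψ-witness {X} {n} (t , e) =
    let (_ , j , acc) = sound X n t e
    in shifted X j , (λ i → m≤m+n (X i) (offset j i)) , j , isOne-true _ acc

  ψ-bigger-is-less : BiggerIsLess ψ
  ψ-bigger-is-less = ψ-only-ones , λ g h h≫g n (v , c) →
    let (Y , Y≫h , c') = ψ-witness c in ψ-halts (≫-trans h≫g Y≫h) c'

module Density where
  open import Data.List using (filter)
  open import Data.List.Properties using (filter-accept; filter-reject; filter-all)
  open import Data.List.Relation.Unary.All using (All; []; _∷_) renaming (map to All-map; zip to All-zip; lookup to All-lookup)
  open import Data.List.Relation.Unary.All.Properties using (all-filter) renaming (filter⁺ to All-filter⁺; ++⁺ to All-++⁺)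
  open import Data.List.Relation.Unary.AllPairs using ([]; _∷_)
  open import Data.List.Relation.Unary.Unique.Propositional using (Unique)
  open import Data.List.Relation.Unary.Unique.Propositional.Properties using () renaming (filter⁺ to Unique-filter⁺; ++⁺ to Unique-++⁺)
  open import Relation.Nullary using (¬_; ¬?; Dec)
  open import Data.List.Membership.Propositional using (_∈_)
  open import Data.Bool.Properties using () renaming (_≟_ to _≟ᵇ_)
  open import Data.Nat.Tactic.RingSolver using (solve-∀)

  unique-length : ∀ n xs → Unique xs → All (_< n) xs → length xs ≤ n
  unique-length zero [] u a = z≤n
  unique-length zero (x ∷ xs) u (() ∷ a)
  unique-length (suc n) xs u a =
    ≤-trans (drop-top xs u) (s≤s (unique-length n (filter ≢n? xs) (Unique-filter⁺ ≢n? u) below))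
    where
    ≢n? = λ x → ¬? (x ≟ n)
    drop-top : ∀ xs → Unique xs → length xs ≤ suc (length (filter ≢n? xs))
    drop-top [] [] = z≤n
    drop-top (x ∷ xs) (x∉xs ∷ u) with x ≟ n
    ... | yes refl rewrite filter-reject ≢n? {x} {xs} (λ k → k refl)
                         | filter-all ≢n? (All-map (λ x≢y y≡x → x≢y (sym y≡x)) x∉xs) = ≤-refl
    ... | no x≢n rewrite filter-accept ≢n? {x} {xs} x≢n = s≤s (drop-top xs u)
    below : All (_< n) (filter ≢n? xs)
    below = All-map (λ (lt , ne) → ≤∧≢⇒< (m<1+n⇒m≤n lt) ne) (All-zip (All-filter⁺ ≢n? a , all-filter ≢n? xs))

  length-filter-split : ∀ {P : ℕ → Set} (P? : ∀ x → Dec (P x)) xs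
    → length xs ≡ length (filter P? xs) + length (filter (λ x → ¬? (P? x)) xs)
  length-filter-split P? [] = refl
  length-filter-split P? (x ∷ xs) with P? x
  ... | yes p = cong suc (length-filter-split P? xs)
  ... | no ¬p = trans (cong suc (length-filter-split P? xs)) (sym (+-suc _ _))

  density1-mono : ∀ {P Q : ℕ → Set} → (∀ x → P x → Q x) → Density1 P → Density1 Q
  density1-mono P⊆Q dP k with dP k
  ... | N , count = N , λ n N≤n →
        let (xs , u , a , bound) = count n N≤n
        in xs , u , All-map (λ (lt , p) → lt , P⊆Q _ p) a , bound

  intersection-bound : ∀ a b c n k → n * (k + suc k) ≤ (a + b) * (suc k + suc k)
    → n * (k + suc k) ≤ c * (suc k + suc k) → b + c ≤ n → n * k ≤ a * suc k
  intersection-bound a b c n k h1 h2 h3 = *-cancelˡ-≤ 2 (+-cancelˡ-≤ (n * Q) _ _ chain)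
    where
    Q = suc k + suc k
    twice : ∀ n k → n * (suc k + suc k) + 2 * (n * k) ≡ n * (k + suc k) + n * (k + suc k)
    twice = solve-∀
    regroup : ∀ a b c k → (a + b) * (suc k + suc k) + c * (suc k + suc k) ≡ a * (suc k + suc k) + (b + c) * (suc k + suc k)
    regroup = solve-∀
    halve : ∀ a n k → a * (suc k + suc k) + n * (suc k + suc k) ≡ n * (suc k + suc k) + 2 * (a * suc k)
    halve = solve-∀
    chain : n * Q + 2 * (n * k) ≤ n * Q + 2 * (a * suc k)
    chain = begin
      n * Q + 2 * (n * k)                ≡⟨ twice n k ⟩
      n * (k + suc k) + n * (k + suc k)  ≤⟨ +-mono-≤ h1 h2 ⟩
      (a + b) * Q + c * Q                ≡⟨ regroup a b c k ⟩
      a * Q + (b + c) * Q                ≤⟨ +-monoʳ-≤ (a * Q) (*-monoˡ-≤ Q h3) ⟩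
      a * Q + n * Q                      ≡⟨ halve a n k ⟩
      n * Q + 2 * (a * suc k)            ∎
      where open ≤-Reasoning

  -- The intersection of a density-1 real with a density-1 set is density-1:
  -- below n, at most n - |A ∩ n| elements of Q lie outside A.
  density1-∩ : (A : Real) (Q : ℕ → Set) → Density1 (_∈R A) → Density1 Q → Density1 (λ x → x ∈R A × Q x)
  density1-∩ A Q dA dQ k with dA (k + suc k) | dQ (k + suc k)
  ... | N1 , countA | N2 , countQ = N1 ⊔ N2 , λ n le →
    let (ys , uy , ay , hy) = countA n (≤-trans (m≤m⊔n N1 N2) le)
        (xs , ux , ax , hx) = countQ n (≤-trans (m≤n⊔m N1 N2) le)
        zs = filter out? xs
        disjoint : ∀ {v} → ¬ (v ∈ zs × v ∈ ys)
        disjoint (v∈zs , v∈ys) = All-lookup (all-filter out? xs) v∈zs (proj₂ (All-lookup ay v∈ys))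
        bound : length (zs ++ ys) ≤ n
        bound = unique-length n (zs ++ ys) (Unique-++⁺ (Unique-filter⁺ out? ux) uy disjoint)
                  (All-++⁺ (All-map proj₁ (All-filter⁺ out? ax)) (All-map proj₁ ay))
    in filter in? xs , Unique-filter⁺ in? ux
       , All-map (λ ((lt , q) , a) → lt , a , q) (All-zip (All-filter⁺ in? ax , all-filter in? xs))
       , intersection-bound (length (filter in? xs)) (length zs) (length ys) n k
           (subst (λ z → n * (k + suc k) ≤ z * (suc k + suc k)) (length-filter-split in? xs) hx) hy
           (subst (_≤ n) (length-++ zs) bound)
    where
    in? = λ x → A x ≟ᵇ true
    out? = λ x → ¬? (in? x)

open Density using (density1-mono; density1-∩)

mainTheorem19 : (A : Real) (f : ℕ → ℕ) → Density1 (λ n → n ∈R A)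
    → (∃ λ (φ : Functional) → ∀ (g : ℕ → ℕ) → g ≫ f → GenericComputation φ g A)
    → ∃ λ (ψ : Functional) → BiggerIsLess ψ
        × (∀ (g : ℕ → ℕ) → g ≫ f → GenericComputation ψ g A)
mainTheorem19 A f dA (φ , φ-generic) = ψ , ψ-bigger-is-less , ψ-generic
  where
  open Build φ

  φ-correct : ∀ {g} → g ≫ f → ∀ n v → φ ^ g ⟨ n ⟩≃ v → v ≡ bit (A n)
  φ-correct g≫f = proj₂ (proj₂ (φ-generic _ g≫f))

  ψ-generic : ∀ g → g ≫ f → GenericComputation ψ g A
  ψ-generic g g≫f = dense , (λ n v c → inj₂ (ψ-only-ones g n v c)) , correct
    where
    -- n ∈ A ∩ dom φ^g: then φ^g(n) = 1, and g ≫ g.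
    dense : Density1 (Dom ψ g)
    dense = density1-mono
      (λ n (n∈A , v , c) → ψ-halts (λ i → ≤-refl) (subst (φ ^ g ⟨ n ⟩≃_) (trans (φ-correct g≫f n v c) (cong bit n∈A)) c))
      (density1-∩ A (Dom φ g) dA (proj₁ (φ-generic g g≫f)))
    -- ψ^g(n) = 1 comes from φ^Y(n) = 1 for some Y ≫ g ≫ f.
    correct : ∀ n v → ψ ^ g ⟨ n ⟩≃ v → v ≡ bit (A n)
    correct n v c =
      let (Y , Y≫g , c') = ψ-witness c
      in trans (ψ-only-ones g n v c) (φ-correct (≫-trans g≫f Y≫g) n 1 c')
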